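{- For every pair of odd integers $m,n$ with $12\leq m\leq n$, $\chi_{lid}(C_m\square C_n)=4$.
   Context: $C_n$ denotes the cycle on $n$ vertices. A proper $k$-coloring of a graph $G$ is a map $f:V(G)\to\{1,\dots,k\}$ with $f(u)\neq f(v)$ for every edge $uv$. For a vertex $v$, $N[v]$ denotes its closed neighborhood, and $f(S)=\{f(x):x\in S\}$. A lid-coloring of $G$ is a proper coloring $f$ such that for every edge $uv$ with $N[u]\neq N[v]$ we have $f(N[u])\neq f(N[v])$; $\chi_{lid}(G)$ is the smallest number of colors in a lid-coloring of $G$. The Cartesian product $G\square H$ has vertex set $V(G)\times V(H)$, where $(u_1,v_1)$ and $(u_2,v_2)$ are adjacent iff either $u_1=u_2$ and $v_1v_2\in E(H)$, or $v_1=v_2$ and $u_1u_2\in E(G)$. -}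

module Defs where

open import Level using (Level; suc; _⊔_)
open import Data.Nat using (ℕ; _+_; _%_; _≤_)
import Data.Nat as ℕ
open import Data.Fin using (Fin; toℕ)
open import Data.Product using (_×_; Σ; ∃; _,_)
open import Data.Sum using (_⊎_)
open import Relation.Nullary using (¬_)
open import Relation.Binary.PropositionalEquality using (_≡_; _≢_)

record Graph : Set₁ where
  field
    V   : Set
    Adj : V → V → Set
open Graph public

-- The cycle C_n on vertices 0,…,n-1: i adjacent to i+1 (mod n), symmetrised.
-- (Used for n ≥ 3, where this is the usual simple cycle.)
CycNext : (n : ℕ) → Fin n → Fin n → Set
CycNext n i j = (toℕ j ≡ ℕ.suc (toℕ i)) ⊎ (ℕ.suc (toℕ i) ≡ n × toℕ j ≡ 0)

Cycle : (n : ℕ) → Graph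
Cycle n = record
  { V   = Fin n
  ; Adj = λ i j → CycNext n i j ⊎ CycNext n j i
  }

_□_ : Graph → Graph → Graph
G □ H = record
  { V   = V G × V H
  ; Adj = λ { (u₁ , v₁) (u₂ , v₂) →
              (u₁ ≡ u₂ × Adj H v₁ v₂) ⊎ (v₁ ≡ v₂ × Adj G u₁ u₂) }
  }

N[_] : {G : Graph} → V G → V G → Set
N[_] {G} v x = x ≡ v ⊎ Adj G v x

Image : {G : Graph} {k : ℕ} → (V G → Fin k) → (V G → Set) → Fin k → Set
Image {G} f S c = Σ (V G) λ x → S x × f x ≡ c

_≐_ : {A : Set} → (A → Set) → (A → Set) → Set
P ≐ Q = ∀ a → (P a → Q a) × (Q a → P a)

IsProperColoring : (G : Graph) (k : ℕ) → (V G → Fin k) → Set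
IsProperColoring G k f = ∀ u v → Adj G u v → f u ≢ f v

IsLidColoring : (G : Graph) (k : ℕ) → (V G → Fin k) → Set
IsLidColoring G k f =
  IsProperColoring G k f ×
  (∀ u v → Adj G u v → ¬ (N[_] {G} u ≐ N[_] {G} v) →
     ¬ (Image {G} f (N[_] {G} u) ≐ Image {G} f (N[_] {G} v)))

HasLidColoring : Graph → ℕ → Set
HasLidColoring G k = Σ (V G → Fin k) (IsLidColoring G k)

LidChromaticNumber : Graph → ℕ → Set
LidChromaticNumber G k = HasLidColoring G k × (∀ j → HasLidColoring G j → k ≤ j)

Odd : ℕ → Set
Odd m = m % 2 ≡ 1

-- Lower bound: in a lid-colouring with at most three colours, the colour sets f(N[u]) and f(N[v])
-- of two neighbours u, v in a row both contain the two distinct colours f(u) and f(v), and they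
-- differ; so exactly one of them is the whole palette. Being the whole palette therefore alternates
-- along the row, which is an odd cycle: impossible.
--
-- Upper bound: label each cycle by the cyclic word 2 3 4 5 6 0 1 0 1 … 0 1 (it closes up since the
-- length is odd and at least 7) and colour (i , j) by T (ℓ i) (ℓ j) for a fixed 7 × 7 table T with
-- four colours. Colour and colour set at (i , j) depend only on the windows (ℓ (i-1), ℓ i, ℓ (i+1))
-- and (ℓ (j-1), ℓ j, ℓ (j+1)), and only nine windows occur, so the lid conditions come down to
-- finitely many cases, which are decided by evaluation.

module Submission where

open import Defs
open import Agda.Builtin.FromNat using (Number; fromNat)
open import Data.Bool using (Bool; not)
open import Data.Bool.Properties using (not-involutive; not-¬)
open import Data.Empty using (⊥; ⊥-elim)
open import Data.Unit using (tt)
open import Data.Fin as Fin using (Fin; zero; suc; toℕ; fromℕ; inject₁; lower₁)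
import Data.Fin.Literals as FinLiterals
import Data.Nat.Literals as ℕLiterals
open import Data.Fin.Properties as Finₚ using (toℕ-injective; toℕ-fromℕ; toℕ-inject₁; toℕ-lower₁)
open import Data.List using (List; []; _∷_)
open import Data.List.Membership.Propositional using (_∈_)
import Data.List.Membership.DecPropositional as DecMembership
open import Data.List.Relation.Unary.All as All using (All)
open import Data.List.Relation.Unary.Any using (here; there)
open import Data.Nat as ℕ using (ℕ; zero; suc; _+_; _≤_; s≤s)
open import Data.Nat.GeneralisedArithmetic using (fold)
open import Data.Nat.Properties as ℕₚ using (suc-injective)
open import Data.Product using (_×_; _,_; proj₁; proj₂; swap)
open import Data.Sum using (_⊎_; inj₁; inj₂)
open import Data.Vec using (Vec; []; _∷_; lookup)
open import Function using (_∘_; Injective)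
open import Relation.Binary.PropositionalEquality
open import Relation.Nullary using (¬_; Dec; yes; no; does; ¬?; contradiction)
open import Relation.Nullary.Decidable using (toWitness; map′; _×-dec_; _→-dec_)
open import Relation.Unary using (Decidable)

instance
  ℕNumber : Number ℕ
  ℕNumber = ℕLiterals.number

  finNumber : ∀ {k} → Number (Fin k)
  finNumber {k} = FinLiterals.number k

Torus : ℕ → ℕ → Graph
Torus m n = Cycle (suc m) □ Cycle (suc n)

module _ {k : ℕ} where

  next : Fin (suc k) → Fin (suc k)
  next i with k ℕ.≟ toℕ i
  ... | yes _   = zero
  ... | no k≢i = suc (lower₁ i k≢i)

  prev : Fin (suc k) → Fin (suc k)
  prev zero    = fromℕ k
  prev (suc i) = inject₁ i

  toℕ-next : (i : Fin (suc k)) →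
    (k ≡ toℕ i × toℕ (next i) ≡ 0) ⊎ (k ≢ toℕ i × toℕ (next i) ≡ suc (toℕ i))
  toℕ-next i with k ℕ.≟ toℕ i
  ... | yes k≡i = inj₁ (k≡i , refl)
  ... | no k≢i = inj₂ (k≢i , cong suc (toℕ-lower₁ i k≢i))

  CycNext-next : (i : Fin (suc k)) → CycNext (suc k) i (next i)
  CycNext-next i with toℕ-next i
  ... | inj₁ (k≡i , next≡0) = inj₂ (cong suc (sym k≡i) , next≡0)
  ... | inj₂ (_ , next≡1+i) = inj₁ next≡1+i

  CycNext-prev : (i : Fin (suc k)) → CycNext (suc k) (prev i) i
  CycNext-prev zero    = inj₂ (cong suc (toℕ-fromℕ k) , refl)
  CycNext-prev (suc i) = inj₁ (cong suc (sym (toℕ-inject₁ i)))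

  CycNext⇒≡next : ∀ {i j} → CycNext (suc k) i j → j ≡ next i
  CycNext⇒≡next {i} {j} i→j with toℕ-next i | i→j
  ... | inj₁ (_ , next≡0)   | inj₂ (_ , j≡0)     = toℕ-injective (trans j≡0 (sym next≡0))
  ... | inj₂ (_ , next≡1+i) | inj₁ j≡1+i         = toℕ-injective (trans j≡1+i (sym next≡1+i))
  ... | inj₂ (k≢i , _)      | inj₂ (1+i≡1+k , _) = contradiction (sym (suc-injective 1+i≡1+k)) k≢i
  ... | inj₁ (k≡i , _)      | inj₁ j≡1+i         =
    ⊥-elim (ℕₚ.<-irrefl (trans j≡1+i (cong suc (sym k≡i))) (Finₚ.toℕ<n j))

  CycNext⇒≡prev : ∀ {i j} → CycNext (suc k) j i → j ≡ prev i
  CycNext⇒≡prev {zero}  (inj₂ (1+j≡1+k , _)) =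
    toℕ-injective (trans (suc-injective 1+j≡1+k) (sym (toℕ-fromℕ k)))
  CycNext⇒≡prev {suc i} (inj₁ 1+i≡1+j) =
    toℕ-injective (trans (suc-injective (sym 1+i≡1+j)) (sym (toℕ-inject₁ i)))

  next-prev : (i : Fin (suc k)) → next (prev i) ≡ i
  next-prev i = sym (CycNext⇒≡next (CycNext-prev i))

  prev-next : (i : Fin (suc k)) → prev (next i) ≡ i
  prev-next i = sym (CycNext⇒≡prev (CycNext-next i))

  cycle-neighbour : ∀ {i j} → Adj (Cycle (suc k)) i j → j ≡ next i ⊎ j ≡ prev i
  cycle-neighbour (inj₁ i→j) = inj₁ (CycNext⇒≡next i→j)
  cycle-neighbour (inj₂ j→i) = inj₂ (CycNext⇒≡prev j→i)

  next≢id : 1 ≤ k → (i : Fin (suc k)) → next i ≢ i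
  next≢id 1≤k i next≡i with toℕ-next i
  ... | inj₁ (k≡i , next≡0) =
    contradiction (trans k≡i (trans (cong toℕ (sym next≡i)) next≡0)) (ℕₚ.m<n⇒n≢0 1≤k)
  ... | inj₂ (_ , next≡1+i) = ℕₚ.1+n≢n (trans (sym next≡1+i) (cong toℕ next≡i))

fold-flips-odd : ∀ {A : Set} (s : A → A) (b : A → Bool) → (∀ x → b (s x) ≡ not (b x)) →
                 ∀ x t → Odd t → b (fold x s t) ≡ not (b x)
fold-flips-odd s b flips x 1 _ = flips x
fold-flips-odd s b flips x (suc (suc t)) odd = begin
  b (s (s (fold x s t)))       ≡⟨ flips (s (fold x s t)) ⟩
  not (b (s (fold x s t)))     ≡⟨ cong not (flips (fold x s t)) ⟩
  not (not (b (fold x s t)))   ≡⟨ not-involutive _ ⟩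
  b (fold x s t)               ≡⟨ fold-flips-odd s b flips x t odd ⟩
  not (b x)                    ∎
  where open ≡-Reasoning

module _ {k : ℕ} where

  toℕ-fold-next : ∀ t → t ≤ k → toℕ (fold zero next t) ≡ t
  toℕ-fold-next zero    _   = refl
  toℕ-fold-next (suc t) 1+t≤k with toℕ-next (fold {A = Fin (suc k)} zero next t)
  ... | inj₁ (k≡t , _)      = contradiction (trans k≡t (toℕ-fold-next t (ℕₚ.<⇒≤ 1+t≤k))) (ℕₚ.>⇒≢ 1+t≤k)
  ... | inj₂ (_ , next≡1+t) = trans next≡1+t (cong suc (toℕ-fold-next t (ℕₚ.<⇒≤ 1+t≤k)))

  fold-next-wraps : fold zero next (suc k) ≡ zero
  fold-next-wraps with toℕ-next (fold {A = Fin (suc k)} zero next k)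
  ... | inj₁ (_ , next≡0) = toℕ-injective next≡0
  ... | inj₂ (k≢k , _) = contradiction (sym (toℕ-fold-next k ℕₚ.≤-refl)) k≢k

  odd-cycle-not-alternating : Odd (suc k) → (b : Fin (suc k) → Bool) → ¬ (∀ i → b (next i) ≡ not (b i))
  odd-cycle-not-alternating odd b flips =
    not-¬ refl (trans (cong b (sym fold-next-wraps)) (fold-flips-odd next b flips zero (suc k) odd))

module _ {G : Graph} {k : ℕ} (f : V G → Fin k) where

  centre-in-image : ∀ u → Image {G} f (N[_] {G} u) (f u)
  centre-in-image u = u , inj₁ refl , refl

  neighbour-in-image : ∀ {u v} → Adj G u v → Image {G} f (N[_] {G} u) (f v)
  neighbour-in-image {v = v} u~v = v , inj₂ u~v , refl

≐-sym : ∀ {A : Set} {P Q : A → Set} → P ≐ Q → Q ≐ P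
≐-sym P≐Q a = proj₂ (P≐Q a) , proj₁ (P≐Q a)

≐-trans : ∀ {A : Set} {P Q R : A → Set} → P ≐ Q → Q ≐ R → P ≐ R
≐-trans P≐Q Q≐R a = proj₁ (Q≐R a) ∘ proj₁ (P≐Q a) , proj₂ (P≐Q a) ∘ proj₂ (Q≐R a)

≐-dec : ∀ {k} {P Q : Fin k → Set} → Decidable P → Decidable Q → Dec (P ≐ Q)
≐-dec P? Q? = Finₚ.all? λ c → (P? c →-dec Q? c) ×-dec (Q? c →-dec P? c)

module _ {m n k : ℕ} (f : Fin (suc m) × Fin (suc n) → Fin k) where

  nbhdColours : Fin (suc m) → Fin (suc n) → List (Fin k)
  nbhdColours i j = f (i , j) ∷ f (next i , j) ∷ f (prev i , j) ∷ f (i , next j) ∷ f (i , prev j) ∷ []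

  image≐nbhdColours : ∀ i j → Image {Torus m n} f (N[_] {Torus m n} (i , j)) ≐ (_∈ nbhdColours i j)
  image≐nbhdColours i j c = sound , complete
    where
    sound : Image {Torus m n} f (N[_] {Torus m n} (i , j)) c → c ∈ nbhdColours i j
    sound (_ , inj₁ refl , refl) = here refl
    sound ((_ , j′) , inj₂ (inj₁ (refl , j~j′)) , refl) with cycle-neighbour j~j′
    ... | inj₁ refl = there (there (there (here refl)))
    ... | inj₂ refl = there (there (there (there (here refl))))
    sound ((i′ , _) , inj₂ (inj₂ (refl , i~i′)) , refl) with cycle-neighbour i~i′
    ... | inj₁ refl = there (here refl)
    ... | inj₂ refl = there (there (here refl))

    seen : ∀ {v} → Adj (Torus m n) (i , j) v → Image {Torus m n} f (N[_] {Torus m n} (i , j)) (f v)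
    seen = neighbour-in-image {Torus m n} f

    complete : c ∈ nbhdColours i j → Image {Torus m n} f (N[_] {Torus m n} (i , j)) c
    complete (here refl) = centre-in-image {Torus m n} f (i , j)
    complete (there (here refl)) = seen (inj₂ (refl , inj₁ (CycNext-next i)))
    complete (there (there (here refl))) = seen (inj₂ (refl , inj₂ (CycNext-prev i)))
    complete (there (there (there (here refl)))) = seen (inj₁ (refl , inj₁ (CycNext-next j)))
    complete (there (there (there (there (here refl))))) = seen (inj₁ (refl , inj₂ (CycNext-prev j)))

  image-dec : ∀ i j → Decidable (Image {Torus m n} f (N[_] {Torus m n} (i , j)))
  image-dec i j c = map′ (proj₂ (image≐nbhdColours i j c)) (proj₁ (image≐nbhdColours i j c))
                         (DecMembership._∈?_ Fin._≟_ c (nbhdColours i j))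

-- Lid-colourings with at most three colours

module _ {k : ℕ} (k≤3 : k ≤ 3) where

  no-four-distinct : {a b c d : Fin k} → a ≢ b → a ≢ c → a ≢ d → b ≢ c → b ≢ d → c ≢ d → ⊥
  no-four-distinct {a} {b} {c} {d} a≢b a≢c a≢d b≢c b≢d c≢d =
    ℕₚ.<⇒≱ (s≤s k≤3) (Finₚ.injective⇒≤ injective)
    where
    injective : Injective _≡_ _≡_ (lookup (a ∷ b ∷ c ∷ d ∷ []))
    injective {zero} {zero} _ = refl
    injective {zero} {suc zero} a≡b = contradiction a≡b a≢b
    injective {zero} {suc (suc zero)} a≡c = contradiction a≡c a≢c
    injective {zero} {suc (suc (suc zero))} a≡d = contradiction a≡d a≢d
    injective {suc zero} {zero} b≡a = contradiction (sym b≡a) a≢b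
    injective {suc zero} {suc zero} _ = refl
    injective {suc zero} {suc (suc zero)} b≡c = contradiction b≡c b≢c
    injective {suc zero} {suc (suc (suc zero))} b≡d = contradiction b≡d b≢d
    injective {suc (suc zero)} {zero} c≡a = contradiction (sym c≡a) a≢c
    injective {suc (suc zero)} {suc zero} c≡b = contradiction (sym c≡b) b≢c
    injective {suc (suc zero)} {suc (suc zero)} _ = refl
    injective {suc (suc zero)} {suc (suc (suc zero))} c≡d = contradiction c≡d c≢d
    injective {suc (suc (suc zero))} {zero} d≡a = contradiction (sym d≡a) a≢d
    injective {suc (suc (suc zero))} {suc zero} d≡b = contradiction (sym d≡b) b≢d
    injective {suc (suc (suc zero))} {suc (suc zero)} d≡c = contradiction (sym d≡c) c≢d
    injective {suc (suc (suc zero))} {suc (suc (suc zero))} _ = refl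

  full-if-extra-colour : {P Q : Fin k → Set} {a b c : Fin k} → a ≢ b → P a → P b → Q a → Q b →
    P c → ¬ Q c → (∀ x → P x) × ¬ (∀ x → Q x)
  full-if-extra-colour {P} {a = a} {b} {c} a≢b Pa Pb Qa Qb Pc ¬Qc = full , λ Qall → ¬Qc (Qall c)
    where
    c≢a : c ≢ a
    c≢a refl = ¬Qc Qa
    c≢b : c ≢ b
    c≢b refl = ¬Qc Qb
    full : ∀ x → P x
    full x with x Fin.≟ a | x Fin.≟ b | x Fin.≟ c
    ... | yes refl | _        | _        = Pa
    ... | no _     | yes refl | _        = Pb
    ... | no _     | no _     | yes refl = Pc
    ... | no x≢a   | no x≢b   | no x≢c   =
      ⊥-elim (no-four-distinct a≢b (c≢a ∘ sym) (x≢a ∘ sym)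
                               (c≢b ∘ sym) (x≢b ∘ sym) (x≢c ∘ sym))

  exactly-one-full : {P Q : Fin k → Set} {a b : Fin k} → Decidable P → Decidable Q →
    a ≢ b → P a → P b → Q a → Q b → ¬ (P ≐ Q) →
    ((∀ x → P x) × ¬ (∀ x → Q x)) ⊎ (¬ (∀ x → P x) × (∀ x → Q x))
  exactly-one-full P? Q? a≢b Pa Pb Qa Qb P≭Q
    with Finₚ.¬∀⟶∃¬ k _ (λ c → (P? c →-dec Q? c) ×-dec (Q? c →-dec P? c)) P≭Q
  ... | c , P≭Q-at-c with P? c | Q? c
  ...   | yes Pc | yes Qc = contradiction ((λ _ → Qc) , (λ _ → Pc)) P≭Q-at-c
  ...   | no ¬Pc | no ¬Qc = contradiction ((⊥-elim ∘ ¬Pc) , (⊥-elim ∘ ¬Qc)) P≭Q-at-c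
  ...   | yes Pc | no ¬Qc = inj₁ (full-if-extra-colour a≢b Pa Pb Qa Qb Pc ¬Qc)
  ...   | no ¬Pc | yes Qc = inj₂ (swap (full-if-extra-colour a≢b Qa Qb Pa Pb Qc ¬Pc))

does-flip : ∀ {A B : Set} (A? : Dec A) (B? : Dec B) → (A × ¬ B) ⊎ (¬ A × B) → does B? ≡ not (does A?)
does-flip (yes _) (no _)  _               = refl
does-flip (no _)  (yes _) _               = refl
does-flip (yes _) (yes B) (inj₁ (_ , ¬B)) = contradiction B ¬B
does-flip (yes A) (yes _) (inj₂ (¬A , _)) = contradiction A ¬A
does-flip (no ¬A) (no _)  (inj₁ (A , _))  = contradiction A ¬A
does-flip (no _)  (no ¬B) (inj₂ (_ , B))  = contradiction B ¬B

module _ {m n : ℕ} (1≤m : 1 ≤ m) (1≤n : 1 ≤ n) where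

  closed-nbhds-differ : ∀ i j → ¬ (N[_] {Torus m n} (i , j) ≐ N[_] {Torus m n} (next i , j))
  closed-nbhds-differ i j same with proj₁ (same (i , next j)) (inj₂ (inj₁ (refl , inj₁ (CycNext-next j))))
  ... | inj₁ i,next-j≡next-i,j     = next≢id 1≤n j (cong proj₂ i,next-j≡next-i,j)
  ... | inj₂ (inj₁ (next-i≡i , _)) = next≢id 1≤m i next-i≡i
  ... | inj₂ (inj₂ (j≡next-j , _)) = next≢id 1≤n j (sym j≡next-j)

  no-lid-colouring-below-four : ∀ {k} → k ≤ 3 → Odd (suc m) → ¬ HasLidColoring (Torus m n) k
  no-lid-colouring-below-four k≤3 odd (f , proper , lid) = odd-cycle-not-alternating odd full? alternates
    where
    all-seen? : ∀ i → Dec (∀ c → Image {Torus m n} f (N[_] {Torus m n} (i , zero)) c)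
    all-seen? i = Finₚ.all? (image-dec f i zero)

    full? : Fin (suc m) → Bool
    full? i = does (all-seen? i)

    alternates : ∀ i → full? (next i) ≡ not (full? i)
    alternates i = does-flip (all-seen? i) (all-seen? (next i))
      (exactly-one-full k≤3 (image-dec f i zero) (image-dec f (next i) zero) (proper _ _ step)
        (centre-in-image {Torus m n} f _) (neighbour-in-image {Torus m n} f step)
        (neighbour-in-image {Torus m n} f step-back) (centre-in-image {Torus m n} f _)
        (lid _ _ step (closed-nbhds-differ i zero)))
      where
      step : Adj (Torus m n) (i , zero) (next i , zero)
      step = inj₂ (refl , inj₁ (CycNext-next i))
      step-back : Adj (Torus m n) (next i , zero) (i , zero)
      step-back = inj₂ (refl , inj₂ (CycNext-next i))

-- A lid-colouring with four colours

record Window : Set where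
  constructor ⟨_,_,_⟩
  field
    before centre after : Fin 7
open Window

Overlaps : Window → Window → Set
Overlaps w w′ = after w ≡ centre w′ × centre w ≡ before w′

windows : List Window
windows = ⟨ 1 , 2 , 3 ⟩ ∷ ⟨ 2 , 3 , 4 ⟩ ∷ ⟨ 3 , 4 , 5 ⟩ ∷ ⟨ 4 , 5 , 6 ⟩ ∷ ⟨ 5 , 6 , 0 ⟩ ∷
          ⟨ 6 , 0 , 1 ⟩ ∷ ⟨ 1 , 0 , 1 ⟩ ∷ ⟨ 0 , 1 , 0 ⟩ ∷ ⟨ 0 , 1 , 2 ⟩ ∷ []

colourTable : Fin 7 → Fin 7 → Fin 4
colourTable x y = lookup (lookup rows x) y
  where
  rows : Vec (Vec (Fin 4) 7) 7
  rows = (2 ∷ 0 ∷ 2 ∷ 1 ∷ 2 ∷ 3 ∷ 0 ∷ []) ∷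
         (1 ∷ 2 ∷ 3 ∷ 0 ∷ 3 ∷ 1 ∷ 2 ∷ []) ∷
         (2 ∷ 1 ∷ 2 ∷ 3 ∷ 0 ∷ 3 ∷ 1 ∷ []) ∷
         (0 ∷ 2 ∷ 0 ∷ 2 ∷ 1 ∷ 2 ∷ 3 ∷ []) ∷
         (3 ∷ 0 ∷ 3 ∷ 0 ∷ 2 ∷ 3 ∷ 0 ∷ []) ∷
         (0 ∷ 1 ∷ 0 ∷ 3 ∷ 1 ∷ 2 ∷ 1 ∷ []) ∷
         (3 ∷ 2 ∷ 3 ∷ 2 ∷ 3 ∷ 0 ∷ 2 ∷ []) ∷ []

localColours : Window → Window → List (Fin 4)
localColours w w′ = colourTable (centre w) (centre w′) ∷ colourTable (after w) (centre w′) ∷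
                    colourTable (before w) (centre w′) ∷ colourTable (centre w) (after w′) ∷
                    colourTable (centre w) (before w′) ∷ []

record Separated (p q : Window × Window) : Set where
  constructor separated
  field
    colours-differ     : colourTable (centre (proj₁ p)) (centre (proj₂ p)) ≢
                         colourTable (centre (proj₁ q)) (centre (proj₂ q))
    colour-sets-differ : ¬ ((_∈ localColours (proj₁ p) (proj₂ p)) ≐
                            (_∈ localColours (proj₁ q) (proj₂ q)))
open Separated

Separated-sym : ∀ {p q} → Separated p q → Separated q p
Separated-sym (separated colours≢ sets≢) = separated (colours≢ ∘ sym) (sets≢ ∘ ≐-sym)

SeparatedAcross : Window → Window → Set
SeparatedAcross w₁ w₂ = All (λ w → Separated (w₁ , w) (w₂ , w) × Separated (w , w₁) (w , w₂)) windows

WindowsSeparated : Set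
WindowsSeparated = All (λ w₁ → All (λ w₂ → Overlaps w₁ w₂ → SeparatedAcross w₁ w₂) windows) windows

windows-separated : WindowsSeparated
windows-separated = toWitness {a? = certificate?} tt
  where
  _∈?_ : (c : Fin 4) (l : List (Fin 4)) → Dec (c ∈ l)
  _∈?_ = DecMembership._∈?_ Fin._≟_
  overlaps? : ∀ w w′ → Dec (Overlaps w w′)
  overlaps? w w′ = (after w Fin.≟ centre w′) ×-dec (centre w Fin.≟ before w′)
  separated? : ∀ p q → Dec (Separated p q)
  separated? (w₁ , w₁′) (w₂ , w₂′) = map′ (λ (c , s) → separated c s) (λ (separated c s) → c , s)
    (¬? (colourTable (centre w₁) (centre w₁′) Fin.≟ colourTable (centre w₂) (centre w₂′)) ×-dec
     ¬? (≐-dec (_∈? localColours w₁ w₁′) (_∈? localColours w₂ w₂′)))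
  across? : ∀ w₁ w₂ → Dec (SeparatedAcross w₁ w₂)
  across? w₁ w₂ =
    All.all? (λ w → separated? (w₁ , w) (w₂ , w) ×-dec separated? (w , w₁) (w , w₂)) windows
  certificate? : Dec WindowsSeparated
  certificate? = All.all? (λ w₁ → All.all? (λ w₂ → overlaps? w₁ w₂ →-dec across? w₁ w₂) windows) windows

alternating : ℕ → Fin 7
alternating zero          = 0
alternating (suc zero)    = 1
alternating (suc (suc s)) = alternating s

label : ℕ → Fin 7
label zero = 2
label (suc zero) = 3
label (suc (suc zero)) = 4
label (suc (suc (suc zero))) = 5
label (suc (suc (suc (suc zero)))) = 6
label (suc (suc (suc (suc (suc s))))) = alternating s

alternating-window : ∀ s → ⟨ alternating s , alternating (suc s) , alternating (suc (suc s)) ⟩ ∈ windows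
alternating-window zero          = there (there (there (there (there (there (there (here refl)))))))
alternating-window (suc zero)    = there (there (there (there (there (there (here refl))))))
alternating-window (suc (suc s)) = alternating-window s

interior-window : ∀ t → ⟨ label t , label (suc t) , label (suc (suc t)) ⟩ ∈ windows
interior-window zero = there (here refl)
interior-window (suc zero) = there (there (here refl))
interior-window (suc (suc zero)) = there (there (there (here refl)))
interior-window (suc (suc (suc zero))) = there (there (there (there (here refl))))
interior-window (suc (suc (suc (suc zero)))) = there (there (there (there (there (here refl)))))
interior-window (suc (suc (suc (suc (suc s))))) = alternating-window s

first-window : ∀ s → Odd s → ⟨ label (5 + s) , label 0 , label 1 ⟩ ∈ windows
first-window zero          ()
first-window (suc zero)    _   = here refl
first-window (suc (suc s)) odd = first-window s odd

last-window : ∀ s → Odd (suc s) → ⟨ label (5 + s) , label (6 + s) , label 0 ⟩ ∈ windows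
last-window zero          _   = there (there (there (there (there (there (there (there (here refl))))))))
last-window (suc zero)    ()
last-window (suc (suc s)) odd = last-window s odd

consecutive-window : ∀ {k} → 6 ≤ k → Odd (suc k) → {p t q : Fin (suc k)} →
  CycNext (suc k) p t → CycNext (suc k) t q →
  ⟨ label (toℕ p) , label (toℕ t) , label (toℕ q) ⟩ ∈ windows
consecutive-window _ _ {p} (inj₁ t≡1+p) (inj₁ q≡1+t)
  rewrite q≡1+t | t≡1+p = interior-window (toℕ p)
consecutive-window (s≤s (s≤s (s≤s (s≤s (s≤s (s≤s {n = r} _))))))
                   odd (inj₂ (1+p≡1+k , t≡0)) (inj₁ q≡1+t)
  rewrite q≡1+t | t≡0 | suc-injective 1+p≡1+k = first-window (suc r) odd
consecutive-window (s≤s (s≤s (s≤s (s≤s (s≤s (s≤s {n = r} _))))))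
                   odd (inj₁ t≡1+p) (inj₂ (1+t≡1+k , q≡0))
  rewrite q≡0 | t≡1+p | suc-injective (suc-injective 1+t≡1+k) = last-window r odd
consecutive-window 6≤k _ (inj₂ (_ , t≡0)) (inj₂ (1+t≡1+k , _)) =
  contradiction (trans (sym t≡0) (suc-injective 1+t≡1+k)) (ℕₚ.m<n⇒n≢0 6≤k ∘ sym)

module _ {k : ℕ} where

  window : Fin (suc k) → Window
  window i = ⟨ label (toℕ (prev i)) , label (toℕ i) , label (toℕ (next i)) ⟩

  window-overlaps-next : ∀ i → Overlaps (window i) (window (next i))
  window-overlaps-next i = refl , cong (label ∘ toℕ) (sym (prev-next i))

  window∈windows : 6 ≤ k → Odd (suc k) → ∀ i → window i ∈ windows
  window∈windows 6≤k odd i = consecutive-window 6≤k odd (CycNext-prev i) (CycNext-next i)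

next-window-separated : ∀ {k} → 6 ≤ k → Odd (suc k) → (i : Fin (suc k)) →
  SeparatedAcross (window i) (window (next i))
next-window-separated 6≤k odd i =
  All.lookup (All.lookup windows-separated (window∈windows 6≤k odd i)) (window∈windows 6≤k odd (next i))
    (window-overlaps-next i)

windowColouring : ∀ {m n} → Fin (suc m) × Fin (suc n) → Fin 4
windowColouring (i , j) = colourTable (label (toℕ i)) (label (toℕ j))

module _ {m n : ℕ} (6≤m : 6 ≤ m) (6≤n : 6 ≤ n) (odd-m : Odd (suc m)) (odd-n : Odd (suc n)) where

  horizontal : ∀ i j → Separated (window i , window j) (window (next i) , window j)
  horizontal i j = proj₁ (All.lookup (next-window-separated 6≤m odd-m i) (window∈windows 6≤n odd-n j))

  vertical : ∀ i j → Separated (window i , window j) (window i , window (next j))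
  vertical i j = proj₂ (All.lookup (next-window-separated 6≤n odd-n j) (window∈windows 6≤m odd-m i))

  adjacent-windows-separated : ∀ {i i′ j j′} → Adj (Torus m n) (i , j) (i′ , j′) →
    Separated (window i , window j) (window i′ , window j′)
  adjacent-windows-separated {i} {j = j} (inj₁ (refl , j~j′)) with cycle-neighbour j~j′
  ... | inj₁ refl = vertical i j
  ... | inj₂ refl = Separated-sym (subst (λ x → Separated (window i , window (prev j)) (window i , window x))
                                         (next-prev j) (vertical i (prev j)))
  adjacent-windows-separated {i} {j = j} (inj₂ (refl , i~i′)) with cycle-neighbour i~i′
  ... | inj₁ refl = horizontal i j
  ... | inj₂ refl = Separated-sym (subst (λ x → Separated (window (prev i) , window j) (window x , window j))
                                         (next-prev i) (horizontal (prev i) j))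

  windowColouring-lid : IsLidColoring (Torus m n) 4 windowColouring
  windowColouring-lid =
    (λ _ _ u~v → colours-differ (adjacent-windows-separated u~v)) ,
    λ { (i , j) (i′ , j′) u~v _ images≐ → colour-sets-differ (adjacent-windows-separated u~v)
          (≐-trans (≐-sym (image≐nbhdColours windowColouring i j))
                   (≐-trans images≐ (image≐nbhdColours windowColouring i′ j′))) }

lemma11 : (m n : ℕ) → Odd m → Odd n → 12 ≤ m → m ≤ n →
    LidChromaticNumber (Cycle m □ Cycle n) 4
lemma11 (suc m) (suc n) odd-m odd-n (s≤s 11≤m) (s≤s m≤n) =
  (windowColouring , windowColouring-lid 6≤m 6≤n odd-m odd-n) , at-least-four
  where
  6≤m : 6 ≤ m
  6≤m = ℕₚ.≤-trans (ℕₚ.m≤m+n 6 5) 11≤m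
  6≤n : 6 ≤ n
  6≤n = ℕₚ.≤-trans 6≤m m≤n
  1≤m : 1 ≤ m
  1≤m = ℕₚ.≤-trans (ℕₚ.m≤m+n 1 5) 6≤m
  1≤n : 1 ≤ n
  1≤n = ℕₚ.≤-trans 1≤m m≤n
  at-least-four : ∀ k → HasLidColoring (Torus m n) k → 4 ≤ k
  at-least-four k colouring with 4 ℕ.≤? k
  ... | yes 4≤k = 4≤k
  ... | no 4≰k = contradiction colouring
    (no-lid-colouring-below-four 1≤m 1≤n (ℕₚ.≤-pred (ℕₚ.≰⇒> 4≰k)) odd-m)
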